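{- If $r \geq 3$ and $t \geq 1$ are integers, then for every positive integer $n$, \[ \mathrm{ex}_r\big(n, \{C_2, C_3, K_{2,t+1}\}\big) \leq \frac{\sqrt{t}}{r(r-1)}\, n^{3/2} + \frac{n}{r}. \]
   Context: Let $G$ be a multigraph and $\mathcal{F}$ a hypergraph. $\mathcal{F}$ is a Berge-$G$ if there is a bijection $f: E(G) \to E(\mathcal{F})$ with $e \subseteq f(e)$ for every $e \in E(G)$. For a family $\mathcal{G}$ of multigraphs, a hypergraph $\mathcal{H}$ is $\mathcal{G}$-free if for every $G \in \mathcal{G}$, no subhypergraph of $\mathcal{H}$ (subset of its edges) is isomorphic to a Berge-$G$. $\mathrm{ex}_r(n,\mathcal{G})$ denotes the maximum number of edges in an $n$-vertex $r$-uniform hypergraph that is $\mathcal{G}$-free. $C_2$ is the multigraph with two vertices and two parallel edges (so $C_2$-free means linear: distinct edges share at most one vertex), $C_3$ is the triangle, and $K_{2,s}$ is the complete bipartite graph with parts of sizes $2$ and $s$. -}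

module Defs where

open import Data.Nat using (ℕ; zero; suc; _+_)
open import Data.Fin using (Fin; zero; suc; _↑ʳ_)
open import Data.Fin.Subset using (Subset; _∈_)
open import Data.List using (List; []; _∷_; _++_; map; length; allFin; lookup)
open import Data.Product using (Σ; _×_; _,_; proj₁; proj₂)
open import Function.Definitions using (Injective)
open import Relation.Binary.PropositionalEquality using (_≡_)
open import Relation.Nullary using (¬_)

-- A (finite, loopless-or-not) multigraph: k vertices Fin k, and a list of
-- edges (pairs of endpoints); repeated pairs in the list are parallel edges.
record Multigraph : Set where
  constructor mkMultigraph
  field
    nV    : ℕ
    edges : List (Fin nV × Fin nV)
open Multigraph public

-- An n-vertex hypergraph is given by a list of edges (subsets of Fin n);
-- distinctness of edges is imposed separately (Unique) in the statement.
Hypergraph : ℕ → Set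
Hypergraph n = List (Subset n)

ContainsBerge : ∀ {n} → Hypergraph n → Multigraph → Set
ContainsBerge {n} H G =
  Σ (Fin (nV G) → Fin n) λ φ → Injective _≡_ _≡_ φ ×
  Σ (Fin (length (edges G)) → Fin (length H)) λ ψ → Injective _≡_ _≡_ ψ ×
  (∀ i → (φ (proj₁ (lookup (edges G) i)) ∈ lookup H (ψ i))
       × (φ (proj₂ (lookup (edges G) i)) ∈ lookup H (ψ i)))

BergeFree : ∀ {n} → Hypergraph n → Multigraph → Set
BergeFree H G = ¬ ContainsBerge H G

C₂ : Multigraph
C₂ = mkMultigraph 2 ((zero , suc zero) ∷ (zero , suc zero) ∷ [])

C₃ : Multigraph
C₃ = mkMultigraph 3 ((zero , suc zero) ∷ (suc zero , suc (suc zero)) ∷ (zero , suc (suc zero)) ∷ [])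

-- K_{2,s}: vertices 0,1 form the part of size 2; vertices 2+j (j < s) the other part.
K₂ : ℕ → Multigraph
K₂ s = mkMultigraph (2 + s)
  (map (λ j → (zero , 2 ↑ʳ j)) (allFin s) ++ map (λ j → (suc zero , 2 ↑ʳ j)) (allFin s))

module Submission where

-- The proof counts in the 2-shadow Γ of H, the graph joining distinct
-- vertices that share an edge; d(u) is the degree of u in Γ, D = Σ d(u), and
-- the codegree c(u,w) is the number of common Γ-neighbours of u and w.
--  * Linearity makes the r(r-1) ordered pairs inside each edge distinct
--    arcs of Γ, so D ≥ r(r-1)m.
--  * If u, w are adjacent, triangle-freeness puts every common neighbour in
--    the edge through u and w, so c(u,w) ≤ r - 2; if they are distinct and
--    non-adjacent, t + 1 common neighbours would span a Berge-K_{2,t+1}, so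
--    c(u,w) ≤ t.  Hence Σ d(v)² = Σ_{u,w} c(u,w) ≤ (r-1)D + t n².
--  * Cauchy–Schwarz, D² ≤ n Σ d(v)², gives D² ≤ (r-1)nD + t n³, which
--    rearranges to the claim since r(r-1)m ≤ D.

open import Defs
open import Data.Bool using (if_then_else_)
open import Data.Fin using (Fin; zero; suc; _↑ʳ_)
import Data.Fin as Fin
open import Data.Fin.Properties using (suc-injective; any?) renaming (_≟_ to _≟ᶠ_)
open import Data.Fin.Subset using (Subset; _∈_; ∣_∣; inside; outside)
open import Data.Fin.Subset.Properties using (_∈?_)
open import Data.List using (List; length; lookup; map; allFin)
open import Data.List.Membership.Propositional.Properties using (∈-lookup; ∈-map⁻)
open import Data.List.Relation.Binary.Disjoint.Propositional using (Disjoint)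
open import Data.List.Relation.Unary.All using (All)
import Data.List.Relation.Unary.All as All
import Data.List.Relation.Unary.All.Properties as All
open import Data.List.Relation.Unary.AllPairs using (_∷_)
open import Data.List.Relation.Unary.Unique.Propositional using (Unique)
import Data.List.Relation.Unary.Unique.Propositional.Properties as Unique
open import Data.Nat using (ℕ; zero; suc; _+_; _*_; _∸_; _^_; _≤_; _≤?_; z≤n; s≤s⁻¹)
open import Data.Nat.Properties hiding (suc-injective; _≟_)
open import Data.Nat.Solver using (module +-*-Solver)
open import Data.Product using (Σ; _×_; _,_; ∃; proj₁; proj₂)
open import Data.Sum using (_⊎_; inj₁; inj₂)
open import Data.Vec using ([]; _∷_)
open import Function.Definitions using (Injective)
open import Relation.Binary.PropositionalEquality
open import Relation.Nullary using (¬_; Dec; yes; no; does; ¬?; _×-dec_; contradiction; decidable-stable)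

open import Algebra.Properties.CommutativeSemigroup +-commutativeSemigroup using (x∙yz≈y∙xz)
open import Algebra.Properties.Semiring.Sum +-*-semiring
  using (sum; sum-cong-≗; ∑-distrib-+; ∑-comm; *-distribˡ-sum; *-distribʳ-sum)
open +-*-Solver using (solve; _:+_; _:*_; _:^_; _:=_; con)

sum-mono : ∀ {k} {f g : Fin k → ℕ} → (∀ i → f i ≤ g i) → sum f ≤ sum g
sum-mono {zero}  f≤g = z≤n
sum-mono {suc k} f≤g = +-mono-≤ (f≤g zero) (sum-mono (λ i → f≤g (suc i)))

sum-const : ∀ {k} c → sum {k} (λ _ → c) ≡ k * c
sum-const {zero}  c = refl
sum-const {suc k} c = cong (c +_) (sum-const {k} c)

sum-squared : ∀ {k} (f : Fin k → ℕ) → sum f * sum f ≡ sum (λ i → sum (λ j → f i * f j))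
sum-squared f = begin
  sum f * sum f                          ≡⟨ *-distribʳ-sum (sum f) f ⟩
  sum (λ i → f i * sum f)                ≡⟨ sum-cong-≗ (λ i → *-distribˡ-sum (f i) f) ⟩
  sum (λ i → sum (λ j → f i * f j))      ∎
  where open ≡-Reasoning

-- The indicator of a decidable proposition.  It only inspects the boolean
-- `does`, so it computes through `map′`, `¬?` and the like.
ind : ∀ {p} {P : Set p} → Dec P → ℕ
ind d = if does d then 1 else 0

ind-yes : ∀ {p} {P : Set p} (d : Dec P) → P → ind d ≡ 1
ind-yes (yes _) _ = refl
ind-yes (no ¬p) p = contradiction p ¬p

ind-mono : ∀ {p q} {P : Set p} {Q : Set q} (a : Dec P) (b : Dec Q) → (P → Q) → ind a ≤ ind b
ind-mono (yes p) b P⇒Q = ≤-reflexive (sym (ind-yes b (P⇒Q p)))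
ind-mono (no _)  b P⇒Q = z≤n

ind-× : ∀ {p q} {P : Set p} {Q : Set q} (a : Dec P) (b : Dec Q) → ind (a ×-dec b) ≡ ind a * ind b
ind-× (yes _) (yes _) = refl
ind-× (yes _) (no _)  = refl
ind-× (no _)  _       = refl

ind-idem : ∀ {p} {P : Set p} (a : Dec P) → ind a * ind a ≡ ind a
ind-idem (yes _) = refl
ind-idem (no _)  = refl

count : ∀ {k p} {P : Fin k → Set p} → (∀ i → Dec (P i)) → ℕ
count P? = sum (λ i → ind (P? i))

∣p∣≡count : ∀ {n} (p : Subset n) → ∣ p ∣ ≡ count (_∈? p)
∣p∣≡count []            = refl
∣p∣≡count (inside  ∷ p) = cong suc (∣p∣≡count p)
∣p∣≡count (outside ∷ p) = ∣p∣≡count p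

DistinctWitnesses : ∀ {k p} → (Fin k → Set p) → ℕ → Set p
DistinctWitnesses {k} P j = Σ (Fin j → Fin k) λ g → Injective _≡_ _≡_ g × (∀ i → P (g i))

distinct-witnesses : ∀ {k p} {P : Fin k → Set p} (P? : ∀ i → Dec (P i)) j → j ≤ count P? →
  DistinctWitnesses P j
distinct-witnesses P? zero _ = (λ ()) , (λ { {()} }) , (λ ())
distinct-witnesses {suc k} {P = P} P? (suc j) j≤count with P? zero
... | no _ with distinct-witnesses (λ i → P? (suc i)) (suc j) j≤count
...   | g , g-injective , Pg = (λ i → suc (g i)) , (λ e → g-injective (suc-injective e)) , Pg
distinct-witnesses {suc k} {P = P} P? (suc j) j≤count
    | yes p₀ with distinct-witnesses (λ i → P? (suc i)) j (s≤s⁻¹ j≤count)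
...   | g , g-injective , Pg = g′ , g′-injective , Pg′
  where
  g′ : Fin (suc j) → Fin (suc k)
  g′ zero    = zero
  g′ (suc i) = suc (g i)
  g′-injective : Injective _≡_ _≡_ g′
  g′-injective {zero}  {zero}  _ = refl
  g′-injective {suc x} {suc y} e = cong suc (g-injective (suc-injective e))
  Pg′ : ∀ i → P (g′ i)
  Pg′ zero    = p₀
  Pg′ (suc i) = Pg i

few-or-distinct-witnesses : ∀ {k p} {P : Fin k → Set p} (P? : ∀ i → Dec (P i)) j →
  count P? ≤ j ⊎ DistinctWitnesses P (suc j)
few-or-distinct-witnesses P? j with count P? ≤? j
... | yes count≤j = inj₁ count≤j
... | no  count≰j = inj₂ (distinct-witnesses P? (suc j) (≰⇒> count≰j))

_without_ : ∀ {k} → (Fin k → ℕ) → Fin k → Fin k → ℕ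
(f without u) v = f v * ind (¬? (v ≟ᶠ u))

without-≢ : ∀ {k} (f : Fin k → ℕ) {u v} → v ≢ u → (f without u) v ≡ f v
without-≢ f {u} {v} v≢u = trans (cong (f v *_) (ind-yes (¬? (v ≟ᶠ u)) v≢u)) (*-identityʳ (f v))

sum-split : ∀ {k} (f : Fin k → ℕ) u → sum f ≡ f u + sum (f without u)
sum-split {suc k} f zero = cong (f zero +_) (sym (cong₂ _+_ (*-zeroʳ (f zero))
                                                   (sum-cong-≗ (λ i → *-identityʳ (f (suc i))))))
sum-split {suc k} f (suc u) = begin
  f zero + sum (λ i → f (suc i))                                 ≡⟨ cong (f zero +_) (sum-split (λ i → f (suc i)) u) ⟩
  f zero + (f (suc u) + sum ((λ i → f (suc i)) without u))       ≡⟨ x∙yz≈y∙xz (f zero) (f (suc u)) _ ⟩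
  f (suc u) + (f zero + sum ((λ i → f (suc i)) without u))       ≡⟨ cong (λ x → f (suc u) + (x + sum ((λ i → f (suc i)) without u))) (*-identityʳ (f zero)) ⟨
  f (suc u) + sum (f without suc u)                              ∎
  where open ≡-Reasoning

sum-without : ∀ {k} (f : Fin k → ℕ) u → sum (f without u) ≡ sum f ∸ f u
sum-without f u = sym (trans (cong (_∸ f u) (sum-split f u)) (m+n∸m≡n (f u) _))

sum-without-mono : ∀ {k} {f g : Fin k → ℕ} u → (∀ v → v ≢ u → f v ≤ g v) → sum (f without u) ≤ sum g
sum-without-mono {f = f} {g} u f≤g = sum-mono bound
  where
  bound : ∀ v → (f without u) v ≤ g v
  bound v with v ≟ᶠ u
  ... | yes refl = subst (_≤ g v) (sym (*-zeroʳ (f v))) z≤n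
  ... | no v≢u   = subst (_≤ g v) (sym (*-identityʳ (f v))) (f≤g v v≢u)

2ab≤a²+b²-ordered : ∀ {a b} → a ≤ b → 2 * (a * b) ≤ a * a + b * b
2ab≤a²+b²-ordered {a} {b} a≤b =
  subst (λ b → 2 * (a * b) ≤ a * a + b * b) (m+[n∸m]≡n a≤b) (offset (b ∸ a))
  where
  offset : ∀ c → 2 * (a * (a + c)) ≤ a * a + (a + c) * (a + c)
  offset c = subst₂ _≤_
    (solve 2 (λ a c → a :* a :+ a :* a :+ con 2 :* a :* c := con 2 :* (a :* (a :+ c))) refl a c)
    (solve 2 (λ a c → a :* a :+ a :* a :+ con 2 :* a :* c :+ c :* c := a :* a :+ (a :+ c) :* (a :+ c)) refl a c)
    (m≤m+n _ (c * c))

2ab≤a²+b² : ∀ a b → 2 * (a * b) ≤ a * a + b * b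
2ab≤a²+b² a b with ≤-total a b
... | inj₁ a≤b = 2ab≤a²+b²-ordered a≤b
... | inj₂ b≤a = subst₂ _≤_ (cong (2 *_) (*-comm b a)) (+-comm (b * b) (a * a)) (2ab≤a²+b²-ordered b≤a)

-- Cauchy–Schwarz for k naturals: (Σ f)² ≤ k · Σ f², by summing 2ab ≤ a² + b²
-- over all pairs.
cauchy-schwarz : ∀ {k} (f : Fin k → ℕ) → sum f * sum f ≤ k * sum (λ i → f i * f i)
cauchy-schwarz {k} f = *-cancelˡ-≤ 2 (begin
  2 * (sum f * sum f)                            ≡⟨ cong (2 *_) (sum-squared f) ⟩
  2 * sum (λ i → sum (λ j → f i * f j))          ≡⟨ *-distribˡ-sum 2 (λ i → sum (λ j → f i * f j)) ⟩
  sum (λ i → 2 * sum (λ j → f i * f j))          ≡⟨ sum-cong-≗ (λ i → *-distribˡ-sum 2 (λ j → f i * f j)) ⟩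
  sum (λ i → sum (λ j → 2 * (f i * f j)))        ≤⟨ sum-mono (λ i → sum-mono (λ j → 2ab≤a²+b² (f i) (f j))) ⟩
  sum (λ i → sum (λ j → f i * f i + f j * f j))  ≡⟨ sum-cong-≗ (λ i → ∑-distrib-+ (λ _ → f i * f i) (λ j → f j * f j)) ⟩
  sum (λ i → sum {k} (λ _ → f i * f i) + Q)      ≡⟨ ∑-distrib-+ (λ i → sum {k} (λ _ → f i * f i)) (λ _ → Q) ⟩
  sum (λ i → sum {k} (λ _ → f i * f i)) + sum {k} (λ _ → Q)
                                                 ≡⟨ cong₂ _+_ (sum-cong-≗ (λ i → sum-const {k} (f i * f i))) (sum-const {k} Q) ⟩
  sum (λ i → k * (f i * f i)) + k * Q            ≡⟨ cong (_+ k * Q) (*-distribˡ-sum k (λ i → f i * f i)) ⟨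
  k * Q + k * Q                                  ≡⟨ cong (k * Q +_) (+-identityʳ (k * Q)) ⟨
  2 * (k * Q)                                    ∎)
  where
  open ≤-Reasoning
  Q : ℕ
  Q = sum (λ i → f i * f i)

-- The final rearrangement: X ≤ D and D² ≤ aD + T give (X ∸ a)² ≤ T.
-- Writing D = a + e, the hypothesis says ae + e² ≤ T.
square-bound : ∀ {X D} a T → X ≤ D → D * D ≤ a * D + T → (X ∸ a) ^ 2 ≤ T
square-bound {X} {D} a T X≤D D²≤aD+T with ≤-total D a
... | inj₁ D≤a rewrite m≤n⇒m∸n≡0 (≤-trans X≤D D≤a) = z≤n
... | inj₂ a≤D = begin
  (X ∸ a) ^ 2      ≤⟨ ^-monoˡ-≤ 2 (∸-monoˡ-≤ a X≤D) ⟩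
  e ^ 2            ≤⟨ m≤n+m (e ^ 2) (a * e) ⟩
  a * e + e ^ 2    ≤⟨ +-cancelˡ-≤ (a * (a + e)) _ _ expanded ⟩
  T                ∎
  where
  open ≤-Reasoning
  e : ℕ
  e = D ∸ a
  expanded : a * (a + e) + (a * e + e ^ 2) ≤ a * (a + e) + T
  expanded = subst (_≤ a * (a + e) + T)
    (solve 2 (λ a e → (a :+ e) :* (a :+ e) := a :* (a :+ e) :+ (a :* e :+ e :^ 2)) refl a e)
    (subst (λ D → D * D ≤ a * D + T) (sym (m+[n∸m]≡n a≤D)) D²≤aD+T)

pair : ∀ {a} {A : Set a} → A → A → Fin 2 → A
pair x y zero       = x
pair x y (suc zero) = y

pair-injective : ∀ {a} {A : Set a} {x y : A} → x ≢ y → Injective _≡_ _≡_ (pair x y)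
pair-injective x≢y {zero}     {zero}     _ = refl
pair-injective x≢y {zero}     {suc zero} e = contradiction e x≢y
pair-injective x≢y {suc zero} {zero}     e = contradiction (sym e) x≢y
pair-injective x≢y {suc zero} {suc zero} _ = refl

triple : ∀ {a} {A : Set a} → A → A → A → Fin 3 → A
triple x y z zero             = x
triple x y z (suc zero)       = y
triple x y z (suc (suc zero)) = z

triple-injective : ∀ {a} {A : Set a} {x y z : A} → x ≢ y → y ≢ z → x ≢ z →
                   Injective _≡_ _≡_ (triple x y z)
triple-injective x≢y y≢z x≢z {zero}             {zero}             _ = refl
triple-injective x≢y y≢z x≢z {zero}             {suc zero}         e = contradiction e x≢y
triple-injective x≢y y≢z x≢z {zero}             {suc (suc zero)}   e = contradiction e x≢z
triple-injective x≢y y≢z x≢z {suc zero}         {zero}             e = contradiction (sym e) x≢y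
triple-injective x≢y y≢z x≢z {suc zero}         {suc zero}         _ = refl
triple-injective x≢y y≢z x≢z {suc zero}         {suc (suc zero)}   e = contradiction e y≢z
triple-injective x≢y y≢z x≢z {suc (suc zero)}   {zero}             e = contradiction (sym e) x≢z
triple-injective x≢y y≢z x≢z {suc (suc zero)}   {suc zero}         e = contradiction (sym e) y≢z
triple-injective x≢y y≢z x≢z {suc (suc zero)}   {suc (suc zero)}   _ = refl

lookup-injective : ∀ {a} {X : Set a} {xs : List X} → Unique xs →
                   ∀ {i j} → lookup xs i ≡ lookup xs j → i ≡ j
lookup-injective (_    ∷ _)      {zero}  {zero}  _ = refl
lookup-injective (x∉xs ∷ _)      {zero}  {suc j} e = contradiction e (All.lookup x∉xs (∈-lookup j))
lookup-injective (x∉xs ∷ _)      {suc i} {zero}  e = contradiction (sym e) (All.lookup x∉xs (∈-lookup i))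
lookup-injective (_    ∷ unique) {suc i} {suc j} e = cong suc (lookup-injective unique e)

data Spoke (s : ℕ) : Fin (2 + s) × Fin (2 + s) → Set where
  left  : ∀ j → Spoke s (zero , suc (suc j))
  right : ∀ j → Spoke s (suc zero , suc (suc j))

spokes : ∀ s → All (Spoke s) (edges (K₂ s))
spokes s = All.++⁺ (All.map⁺ (All.universal left (allFin s)))
                   (All.map⁺ (All.universal right (allFin s)))

K₂-simple : ∀ s → Unique (edges (K₂ s))
K₂-simple s = Unique.++⁺ (Unique.map⁺ left-injective (Unique.allFin⁺ s))
                         (Unique.map⁺ right-injective (Unique.allFin⁺ s)) left∩right
  where
  left-injective : ∀ {i j : Fin s} → (Fin.zero {suc s} , 2 ↑ʳ i) ≡ (zero , 2 ↑ʳ j) → i ≡ j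
  left-injective refl = refl
  right-injective : ∀ {i j : Fin s} → (Fin.suc {suc s} zero , 2 ↑ʳ i) ≡ (suc zero , 2 ↑ʳ j) → i ≡ j
  right-injective refl = refl
  left∩right : Disjoint (map (λ j → (zero , 2 ↑ʳ j)) (allFin s)) (map (λ j → (suc zero , 2 ↑ʳ j)) (allFin s))
  left∩right (p , q) with ∈-map⁻ (λ j → (Fin.zero {suc s} , 2 ↑ʳ j)) p
                        | ∈-map⁻ (λ j → (Fin.suc {suc s} zero , 2 ↑ʳ j)) q
  ... | _ , _ , refl | _ , _ , ()

module _ {n} (H : Hypergraph n) where

  private
    E : Fin (length H) → Subset n
    E = lookup H

  -- Linearity: in a Berge-C₂-free hypergraph two distinct vertices lie in at
  -- most one common edge, since two such edges form a Berge-C₂.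
  common-edge-unique : BergeFree H C₂ → ∀ {x y k₁ k₂} → x ≢ y →
    x ∈ E k₁ → y ∈ E k₁ → x ∈ E k₂ → y ∈ E k₂ → k₁ ≡ k₂
  common-edge-unique C₂-free {x} {y} {k₁} {k₂} x≢y x₁ y₁ x₂ y₂ =
    decidable-stable (k₁ ≟ᶠ k₂) λ k₁≢k₂ →
      C₂-free (pair x y , (λ {i j} → pair-injective x≢y {i} {j}) ,
               pair k₁ k₂ , (λ {i j} → pair-injective k₁≢k₂ {i} {j}) ,
               λ { zero → x₁ , y₁ ; (suc zero) → x₂ , y₂ })

  -- In a linear Berge-C₃-free hypergraph, if the pairs xy, yz, xz of three
  -- distinct vertices are covered by edges k₁, k₂, k₃, then k₁ = k₃: if two
  -- of the edges coincide, linearity identifies k₁ and k₃; if all three are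
  -- distinct they form a Berge-C₃.
  triangle-edge : BergeFree H C₂ → BergeFree H C₃ → ∀ {x y z k₁ k₂ k₃} →
    x ≢ y → y ≢ z → x ≢ z → x ∈ E k₁ → y ∈ E k₁ → y ∈ E k₂ → z ∈ E k₂ →
    x ∈ E k₃ → z ∈ E k₃ → k₁ ≡ k₃
  triangle-edge C₂-free C₃-free {x} {y} {z} {k₁} {k₂} {k₃} x≢y y≢z x≢z x₁ y₁ y₂ z₂ x₃ z₃
    with k₁ ≟ᶠ k₃ | k₁ ≟ᶠ k₂ | k₂ ≟ᶠ k₃
  ... | yes k₁≡k₃ | _        | _        = k₁≡k₃
  ... | no _      | yes refl | _        = common-edge-unique C₂-free x≢z x₁ z₂ x₃ z₃
  ... | no _      | no _     | yes refl = common-edge-unique C₂-free x≢y x₁ y₁ x₃ y₂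
  ... | no k₁≢k₃  | no k₁≢k₂ | no k₂≢k₃ = contradiction
        (triple x y z , (λ {i j} → triple-injective x≢y y≢z x≢z {i} {j}) ,
         triple k₁ k₂ k₃ , (λ {i j} → triple-injective k₁≢k₂ k₂≢k₃ k₁≢k₃ {i} {j}) ,
         λ { zero → x₁ , y₁ ; (suc zero) → y₂ , z₂ ; (suc (suc zero)) → x₃ , z₃ })
        C₃-free

  Adjacent : Fin n → Fin n → Set
  Adjacent u v = u ≢ v × ∃ λ k → u ∈ E k × v ∈ E k

  edge-of : ∀ {u v} → Adjacent u v → Fin (length H)
  edge-of (_ , k , _ , _) = k

  ∈edge-of₁ : ∀ {u v} (uv : Adjacent u v) → u ∈ E (edge-of uv)
  ∈edge-of₁ (_ , _ , u∈ , _) = u∈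

  ∈edge-of₂ : ∀ {u v} (uv : Adjacent u v) → v ∈ E (edge-of uv)
  ∈edge-of₂ (_ , _ , _ , v∈) = v∈

  -- The spoke u–g j goes to an edge a j through u and g j, the spoke w–g j to
  -- an edge b j through w and g j.  These 2s edges are distinct: a i = b j
  -- would cover u and w, while a i = a j (or b i = b j) for i ≠ j makes
  -- g i, g j, w (or g i, g j, u) a triangle, forcing a i = b i.
  common-neighbours⇒K₂ : BergeFree H C₂ → BergeFree H C₃ → ∀ {s u w} →
    u ≢ w → ¬ Adjacent u w → (g : Fin s → Fin n) → Injective _≡_ _≡_ g →
    (∀ j → Adjacent (g j) u × Adjacent (g j) w) → ContainsBerge H (K₂ s)
  common-neighbours⇒K₂ C₂-free C₃-free {s} {u} {w} u≢w u≁w g g-injective common =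
    φ , (λ {i j} → φ-injective {i} {j}) , ψ , (λ {i j} → ψ-injective {i} {j}) ,
    λ i → spoke-covered (spoke i)
    where
    gu : ∀ j → Adjacent (g j) u
    gu j = proj₁ (common j)
    gw : ∀ j → Adjacent (g j) w
    gw j = proj₂ (common j)

    a b : Fin s → Fin (length H)
    a j = edge-of (gu j)
    b j = edge-of (gw j)

    a≢b : ∀ i j → a i ≢ b j
    a≢b i j a≡b = u≁w (u≢w , a i , ∈edge-of₂ (gu i) , subst (w ∈_) (cong E (sym a≡b)) (∈edge-of₂ (gw j)))

    g-distinct : ∀ {i j} → i ≢ j → g i ≢ g j
    g-distinct i≢j e = i≢j (g-injective e)

    a-injective : ∀ {i j} → a i ≡ a j → i ≡ j
    a-injective {i} {j} a≡a = decidable-stable (i ≟ᶠ j) λ i≢j → a≢b i i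
      (triangle-edge C₂-free C₃-free (g-distinct i≢j) (proj₁ (gw j)) (proj₁ (gw i))
        (∈edge-of₁ (gu i)) (subst (g j ∈_) (cong E (sym a≡a)) (∈edge-of₁ (gu j)))
        (∈edge-of₁ (gw j)) (∈edge-of₂ (gw j)) (∈edge-of₁ (gw i)) (∈edge-of₂ (gw i)))

    b-injective : ∀ {i j} → b i ≡ b j → i ≡ j
    b-injective {i} {j} b≡b = decidable-stable (i ≟ᶠ j) λ i≢j → a≢b i i (sym
      (triangle-edge C₂-free C₃-free (g-distinct i≢j) (proj₁ (gu j)) (proj₁ (gu i))
        (∈edge-of₁ (gw i)) (subst (g j ∈_) (cong E (sym b≡b)) (∈edge-of₁ (gw j)))
        (∈edge-of₁ (gu j)) (∈edge-of₂ (gu j)) (∈edge-of₁ (gu i)) (∈edge-of₂ (gu i))))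

    φ : Fin (2 + s) → Fin n
    φ zero          = u
    φ (suc zero)    = w
    φ (suc (suc j)) = g j

    φ-injective : Injective _≡_ _≡_ φ
    φ-injective {zero}          {zero}          _ = refl
    φ-injective {zero}          {suc zero}      e = contradiction e u≢w
    φ-injective {zero}          {suc (suc j)}   e = contradiction (sym e) (proj₁ (gu j))
    φ-injective {suc zero}      {zero}          e = contradiction (sym e) u≢w
    φ-injective {suc zero}      {suc zero}      _ = refl
    φ-injective {suc zero}      {suc (suc j)}   e = contradiction (sym e) (proj₁ (gw j))
    φ-injective {suc (suc i)}   {zero}          e = contradiction e (proj₁ (gu i))
    φ-injective {suc (suc i)}   {suc zero}      e = contradiction e (proj₁ (gw i))
    φ-injective {suc (suc i)}   {suc (suc j)}   e = cong (λ k → suc (suc k)) (g-injective e)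

    edge-for : ∀ {p} → Spoke s p → Fin (length H)
    edge-for (left j)  = a j
    edge-for (right j) = b j

    edge-for-injective : ∀ {p q} (sp : Spoke s p) (sq : Spoke s q) → edge-for sp ≡ edge-for sq → p ≡ q
    edge-for-injective (left i)  (left j)  e = cong (λ k → zero , suc (suc k)) (a-injective e)
    edge-for-injective (left i)  (right j) e = contradiction e (a≢b i j)
    edge-for-injective (right i) (left j)  e = contradiction (sym e) (a≢b j i)
    edge-for-injective (right i) (right j) e = cong (λ k → suc zero , suc (suc k)) (b-injective e)

    spoke-covered : ∀ {p} (sp : Spoke s p) → φ (proj₁ p) ∈ E (edge-for sp) × φ (proj₂ p) ∈ E (edge-for sp)
    spoke-covered (left j)  = ∈edge-of₂ (gu j) , ∈edge-of₁ (gu j)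
    spoke-covered (right j) = ∈edge-of₂ (gw j) , ∈edge-of₁ (gw j)

    spoke : (i : Fin (length (edges (K₂ s)))) → Spoke s (lookup (edges (K₂ s)) i)
    spoke i = All.lookup (spokes s) (∈-lookup i)

    ψ : Fin (length (edges (K₂ s))) → Fin (length H)
    ψ i = edge-for (spoke i)

    ψ-injective : Injective _≡_ _≡_ ψ
    ψ-injective {i} {j} e = lookup-injective (K₂-simple s) (edge-for-injective (spoke i) (spoke j) e)

  Adjacent? : ∀ u v → Dec (Adjacent u v)
  Adjacent? u v = ¬? (u ≟ᶠ v) ×-dec any? (λ k → u ∈? E k ×-dec v ∈? E k)

  Adjacent-sym : ∀ {u v} → Adjacent u v → Adjacent v u
  Adjacent-sym (u≢v , k , u∈ , v∈) = (λ v≡u → u≢v (sym v≡u)) , k , v∈ , u∈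

  inE : Fin (length H) → Fin n → ℕ
  inE k v = ind (v ∈? E k)

  adj : Fin n → Fin n → ℕ
  adj u v = ind (Adjacent? u v)

  degree : Fin n → ℕ
  degree u = sum (adj u)

  codegree : Fin n → Fin n → ℕ
  codegree u w = sum (λ v → adj v u * adj v w)

  common-edges : Fin n → Fin n → ℕ
  common-edges u v = sum (λ k → inE k u * inE k v)

  adj-sym : ∀ u v → adj u v ≡ adj v u
  adj-sym u v = ≤-antisym (ind-mono (Adjacent? u v) (Adjacent? v u) Adjacent-sym)
                          (ind-mono (Adjacent? v u) (Adjacent? u v) Adjacent-sym)

  codegree-self : ∀ u → codegree u u ≡ degree u
  codegree-self u = sum-cong-≗ λ v → trans (ind-idem (Adjacent? v u)) (adj-sym v u)

  common-edges≤adj : BergeFree H C₂ → ∀ {u v} → u ≢ v → common-edges u v ≤ adj u v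
  common-edges≤adj C₂-free {u} {v} u≢v =
    subst (_≤ adj u v) (sum-cong-≗ λ k → ind-× (u ∈? E k) (v ∈? E k)) (bound (Adjacent? u v))
    where
    both? : ∀ k → Dec (u ∈ E k × v ∈ E k)
    both? k = u ∈? E k ×-dec v ∈? E k
    bound : (a : Dec (Adjacent u v)) → count both? ≤ ind a
    bound (yes _) with few-or-distinct-witnesses both? 1
    ... | inj₁ count≤1 = count≤1
    ... | inj₂ (g , g-injective , uv∈g) = contradiction
          (g-injective (common-edge-unique C₂-free u≢v (proj₁ (uv∈g zero)) (proj₂ (uv∈g zero))
                                                      (proj₁ (uv∈g (suc zero))) (proj₂ (uv∈g (suc zero)))))
          (λ ())
    bound (no u≁v) with few-or-distinct-witnesses both? 0
    ... | inj₁ count≤0 = count≤0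
    ... | inj₂ (g , _ , uv∈g) = contradiction (u≢v , g zero , uv∈g zero) u≁v

  edge-size : ∀ {r} → All (λ e → ∣ e ∣ ≡ r) H → ∀ k → sum (inE k) ≡ r
  edge-size uniform k = trans (sym (∣p∣≡count (E k))) (All.lookup uniform (∈-lookup k))

  edge-minus-vertex : ∀ {r} → All (λ e → ∣ e ∣ ≡ r) H → ∀ {k u} → u ∈ E k →
                      sum (inE k without u) ≡ r ∸ 1
  edge-minus-vertex uniform {k} {u} u∈ =
    trans (sum-without (inE k) u) (cong₂ _∸_ (edge-size uniform k) (ind-yes (u ∈? E k) u∈))

  -- Each edge through u supplies r - 1 neighbours of u; by linearity these
  -- are all distinct, so the degree of u is at least r - 1 times the number
  -- of edges through u.
  degree-lb : BergeFree H C₂ → ∀ {r} → All (λ e → ∣ e ∣ ≡ r) H → ∀ u →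
              sum (λ k → inE k u * (r ∸ 1)) ≤ degree u
  degree-lb C₂-free {r} uniform u = begin
    sum (λ k → inE k u * (r ∸ 1))                         ≤⟨ sum-mono (λ k → per-edge k (u ∈? E k)) ⟩
    sum (λ k → inE k u * sum (inE k without u))           ≡⟨ sum-cong-≗ (λ k → *-distribˡ-sum (inE k u) (inE k without u)) ⟩
    sum (λ k → sum (λ v → inE k u * (inE k without u) v)) ≡⟨ ∑-comm (λ k v → inE k u * (inE k without u) v) ⟩
    sum (λ v → sum (λ k → inE k u * (inE k without u) v)) ≡⟨ sum-cong-≗ (λ v → regroup v) ⟩
    sum (common-edges u without u)                        ≤⟨ sum-without-mono u (λ v v≢u → common-edges≤adj C₂-free (λ u≡v → v≢u (sym u≡v))) ⟩
    degree u                                              ∎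
    where
    open ≤-Reasoning
    per-edge : ∀ k (u∈? : Dec (u ∈ E k)) → ind u∈? * (r ∸ 1) ≤ ind u∈? * sum (inE k without u)
    per-edge k (yes u∈) = ≤-reflexive (cong (1 *_) (sym (edge-minus-vertex uniform u∈)))
    per-edge k (no _)   = z≤n
    regroup : ∀ v → sum (λ k → inE k u * (inE k without u) v) ≡ (common-edges u without u) v
    regroup v = trans (sum-cong-≗ (λ k → sym (*-assoc (inE k u) (inE k v) _)))
                      (sym (*-distribʳ-sum _ (λ k → inE k u * inE k v)))

  -- Double counting the pairs (edge, ordered pair of its vertices):
  -- the degree sum is at least r(r - 1) times the number of edges.
  degree-sum-lb : BergeFree H C₂ → ∀ {r} → All (λ e → ∣ e ∣ ≡ r) H →
                  r * (r ∸ 1) * length H ≤ sum degree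
  degree-sum-lb C₂-free {r} uniform = begin
    r * (r ∸ 1) * length H                             ≡⟨ *-comm (r * (r ∸ 1)) (length H) ⟩
    length H * (r * (r ∸ 1))                           ≡⟨ sum-const {length H} (r * (r ∸ 1)) ⟨
    sum {length H} (λ k → r * (r ∸ 1))                 ≡⟨ sum-cong-≗ (λ k → cong (_* (r ∸ 1)) (edge-size uniform k)) ⟨
    sum (λ k → sum (inE k) * (r ∸ 1))                  ≡⟨ sum-cong-≗ (λ k → *-distribʳ-sum (r ∸ 1) (inE k)) ⟩
    sum (λ k → sum (λ u → inE k u * (r ∸ 1)))          ≡⟨ ∑-comm (λ k u → inE k u * (r ∸ 1)) ⟩
    sum (λ u → sum (λ k → inE k u * (r ∸ 1)))          ≤⟨ sum-mono (degree-lb C₂-free uniform) ⟩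
    sum degree                                         ∎
    where open ≤-Reasoning

  -- Adjacent u, w have at most r - 2 common neighbours: by triangle-freeness
  -- every common neighbour lies in the edge k through u and w.
  codegree-adjacent : BergeFree H C₂ → BergeFree H C₃ → ∀ {r} → All (λ e → ∣ e ∣ ≡ r) H →
                      ∀ {u w} → Adjacent u w → codegree u w ≤ r ∸ 2
  codegree-adjacent C₂-free C₃-free {r} uniform {u} {w} (u≢w , k , u∈ , w∈) = begin
    codegree u w                            ≤⟨ sum-mono common-in-edge ⟩
    sum ((inE k without w) without u)       ≡⟨ sum-without (inE k without w) u ⟩
    sum (inE k without w) ∸ (inE k without w) u
                                            ≡⟨ cong₂ _∸_ (edge-minus-vertex uniform w∈)
                                                         (trans (without-≢ (inE k) u≢w) (ind-yes (u ∈? E k) u∈)) ⟩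
    r ∸ 1 ∸ 1                               ≡⟨ ∸-+-assoc r 1 1 ⟩
    r ∸ 2                                   ∎
    where
    open ≤-Reasoning
    common-in-edge : ∀ v → adj v u * adj v w ≤ ((inE k without w) without u) v
    common-in-edge v = in-edge (Adjacent? v u) (Adjacent? v w)
      where
      in-edge : (vu? : Dec (Adjacent v u)) (vw? : Dec (Adjacent v w)) →
                ind vu? * ind vw? ≤ ((inE k without w) without u) v
      in-edge (no _)  _       = z≤n
      in-edge (yes _) (no _)  = z≤n
      in-edge (yes vu) (yes vw) = ≤-reflexive (sym (begin-equality
        ((inE k without w) without u) v     ≡⟨ without-≢ (inE k without w) (proj₁ vu) ⟩
        (inE k without w) v                 ≡⟨ without-≢ (inE k) (proj₁ vw) ⟩
        inE k v                             ≡⟨ ind-yes (v ∈? E k) v∈k ⟩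
        1                                   ∎))
        where
        uv : Adjacent u v
        uv = Adjacent-sym vu
        uv-edge-is-k : edge-of uv ≡ k
        uv-edge-is-k = triangle-edge C₂-free C₃-free (proj₁ uv) (proj₁ vw) u≢w
          (∈edge-of₁ uv) (∈edge-of₂ uv) (∈edge-of₁ vw) (∈edge-of₂ vw) u∈ w∈
        v∈k : v ∈ E k
        v∈k = subst (v ∈_) (cong E uv-edge-is-k) (∈edge-of₂ uv)

  -- Distinct non-adjacent u, w have at most t common neighbours, since
  -- t + 1 of them would span a Berge-K_{2,t+1}.
  codegree-nonadjacent : BergeFree H C₂ → BergeFree H C₃ → ∀ {t} → BergeFree H (K₂ (t + 1)) →
                         ∀ {u w} → u ≢ w → ¬ Adjacent u w → codegree u w ≤ t
  codegree-nonadjacent C₂-free C₃-free {t} K-free {u} {w} u≢w u≁w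
    with few-or-distinct-witnesses (λ v → Adjacent? v u ×-dec Adjacent? v w) t
  ... | inj₁ count≤t = subst (_≤ t) (sum-cong-≗ λ v → ind-× (Adjacent? v u) (Adjacent? v w)) count≤t
  ... | inj₂ (g , g-injective , common) = contradiction
        (subst (λ s → ContainsBerge H (K₂ s)) (+-comm 1 t)
               (common-neighbours⇒K₂ C₂-free C₃-free u≢w u≁w g g-injective common))
        K-free

  codegree-bound : BergeFree H C₂ → BergeFree H C₃ → ∀ {r t} → All (λ e → ∣ e ∣ ≡ r) H →
                   BergeFree H (K₂ (t + 1)) → ∀ {u w} → u ≢ w → codegree u w ≤ (r ∸ 2) * adj u w + t
  codegree-bound C₂-free C₃-free {r} {t} uniform K-free {u} {w} u≢w = by-adjacency (Adjacent? u w)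
    where
    by-adjacency : (uw? : Dec (Adjacent u w)) → codegree u w ≤ (r ∸ 2) * ind uw? + t
    by-adjacency (yes uw) = ≤-trans (codegree-adjacent C₂-free C₃-free uniform uw)
                                    (≤-trans (≤-reflexive (sym (*-identityʳ (r ∸ 2)))) (m≤m+n _ t))
    by-adjacency (no u≁w) = ≤-trans (codegree-nonadjacent C₂-free C₃-free K-free u≢w u≁w) (m≤n+m t _)

  codegree-row-sum : BergeFree H C₂ → BergeFree H C₃ → ∀ {r t} → 2 ≤ r → All (λ e → ∣ e ∣ ≡ r) H →
                     BergeFree H (K₂ (t + 1)) → ∀ u → sum (codegree u) ≤ (r ∸ 1) * degree u + n * t
  codegree-row-sum C₂-free C₃-free {r} {t} 2≤r uniform K-free u = begin
    sum (codegree u)                                  ≡⟨ sum-split (codegree u) u ⟩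
    codegree u u + sum (codegree u without u)         ≤⟨ +-mono-≤ (≤-reflexive (codegree-self u))
                                                           (sum-without-mono u λ w w≢u →
                                                             codegree-bound C₂-free C₃-free uniform K-free (λ u≡w → w≢u (sym u≡w))) ⟩
    degree u + sum (λ w → (r ∸ 2) * adj u w + t)      ≡⟨ cong (degree u +_) (trans (∑-distrib-+ (λ w → (r ∸ 2) * adj u w) (λ _ → t))
                                                           (cong₂ _+_ (sym (*-distribˡ-sum (r ∸ 2) (adj u))) (sum-const {n} t))) ⟩
    degree u + ((r ∸ 2) * degree u + n * t)           ≡⟨ +-assoc (degree u) _ _ ⟨
    (1 + (r ∸ 2)) * degree u + n * t                  ≡⟨ cong (λ c → c * degree u + n * t) (+-∸-assoc 1 2≤r) ⟨
    (r ∸ 1) * degree u + n * t                        ∎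
    where open ≤-Reasoning

  -- Σ d(v)² counts the paths u – v – w, i.e. the sum of all codegrees.
  degree-square-sum : BergeFree H C₂ → BergeFree H C₃ → ∀ {r t} → 2 ≤ r → All (λ e → ∣ e ∣ ≡ r) H →
                      BergeFree H (K₂ (t + 1)) →
                      sum (λ v → degree v * degree v) ≤ (r ∸ 1) * sum degree + n * (n * t)
  degree-square-sum C₂-free C₃-free {r} {t} 2≤r uniform K-free = begin
    sum (λ v → degree v * degree v)                             ≡⟨ sum-cong-≗ (λ v → sum-squared (adj v)) ⟩
    sum (λ v → sum (λ u → sum (λ w → adj v u * adj v w)))       ≡⟨ ∑-comm (λ v u → sum (λ w → adj v u * adj v w)) ⟩
    sum (λ u → sum (λ v → sum (λ w → adj v u * adj v w)))       ≡⟨ sum-cong-≗ (λ u → ∑-comm (λ v w → adj v u * adj v w)) ⟩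
    sum (λ u → sum (codegree u))                                ≤⟨ sum-mono (codegree-row-sum C₂-free C₃-free 2≤r uniform K-free) ⟩
    sum (λ u → (r ∸ 1) * degree u + n * t)                      ≡⟨ ∑-distrib-+ (λ u → (r ∸ 1) * degree u) (λ _ → n * t) ⟩
    sum (λ u → (r ∸ 1) * degree u) + sum {n} (λ _ → n * t)      ≡⟨ cong₂ _+_ (sym (*-distribˡ-sum (r ∸ 1) degree)) (sum-const {n} (n * t)) ⟩
    (r ∸ 1) * sum degree + n * (n * t)                          ∎
    where open ≤-Reasoning

-- D ≥ r(r-1)m by double counting, and D² ≤ n Σ d(v)² ≤ (r-1)nD + t n³ by
-- Cauchy–Schwarz and the codegree bounds; only r ≥ 2 is needed.
theorem2p1 : (r t n : ℕ) → 3 ≤ r → 1 ≤ t → 1 ≤ n →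
    (H : Hypergraph n) → Unique H → All (λ e → ∣ e ∣ ≡ r) H →
    BergeFree H C₂ → BergeFree H C₃ → BergeFree H (K₂ (t + 1)) →
    (r * (r ∸ 1) * length H ∸ (r ∸ 1) * n) ^ 2 ≤ t * n ^ 3
theorem2p1 r t n 3≤r _ _ H _ uniform C₂-free C₃-free K-free =
  square-bound ((r ∸ 1) * n) (t * n ^ 3) (degree-sum-lb H C₂-free uniform) (begin
    D * D                                       ≤⟨ cauchy-schwarz (degree H) ⟩
    n * sum (λ v → degree H v * degree H v)     ≤⟨ *-monoʳ-≤ n (degree-square-sum H C₂-free C₃-free 2≤r uniform K-free) ⟩
    n * ((r ∸ 1) * D + n * (n * t))             ≡⟨ solve 4 (λ r′ n t D → n :* (r′ :* D :+ n :* (n :* t))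
                                                                       := r′ :* n :* D :+ t :* n :^ 3) refl (r ∸ 1) n t D ⟩
    (r ∸ 1) * n * D + t * n ^ 3                 ∎)
  where
  open ≤-Reasoning
  D : ℕ
  D = sum (degree H)
  2≤r : 2 ≤ r
  2≤r = ≤-trans (n≤1+n 2) 3≤r
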